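{- Let $n\ge 3$ and let $\varphi(\vec{x},\vec{y})$ be a prime generalized $P$-encoding on $n$ input variables whose number of clauses is minimum among all generalized $P$-encodings on $n$ input variables. Then for every $i\in[n]$, $\varphi$ contains more than one clause containing the literal $\overline{x_i}$.
   Context: A CNF formula is a set of clauses (sets of literals). Let $\vec{x}=(x_1,\dots,x_n)$ be input variables and $\vec{y}$ a finite set of auxiliary variables. A CNF $\varphi(\vec{x},\vec{y})$ is a generalized $P$-encoding on $n$ input variables if (a) $\varphi\wedge x_i$ is satisfiable for each $i\in[n]$, and (b) $\varphi\models\overline{x_i}\vee\overline{x_j}$ for all distinct $i,j\in[n]$. It is prime if every CNF obtained from $\varphi$ by removing one literal from one clause is not a generalized $P$-encoding on $n$ input variables. -}

module Defs where

open import Data.Nat using (ℕ; _≤_; _<_)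
open import Data.Fin using (Fin)
open import Data.Bool using (Bool; true; false)
open import Data.Sum using (_⊎_; inj₁; inj₂)
open import Data.Product using (_×_; _,_; Σ; ∃; ∃-syntax)
open import Data.List using (List; []; _∷_; length; lookup)
open import Data.List.Relation.Unary.All using (All)
open import Data.List.Relation.Unary.Any using (Any)
open import Data.List.Membership.Propositional using (_∈_)
open import Relation.Binary.PropositionalEquality using (_≡_; _≢_)
open import Relation.Nullary using (¬_)

-- Variables: n input variables x_i (inj₁ i) and m auxiliary variables y_j (inj₂ j).
Var : ℕ → ℕ → Set
Var n m = Fin n ⊎ Fin m

-- A literal over V: (v , true) is the positive literal v, (v , false) is its negation v̄.
Lit : Set → Set
Lit V = V × Bool

Clause : Set → Set
Clause V = List (Lit V)

CNF : Set → Set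
CNF V = List (Clause V)

Assignment : Set → Set
Assignment V = V → Bool

SatLit : ∀ {V} → Assignment V → Lit V → Set
SatLit α (v , b) = α v ≡ b

SatClause : ∀ {V} → Assignment V → Clause V → Set
SatClause α C = Any (SatLit α) C

SatCNF : ∀ {V} → Assignment V → CNF V → Set
SatCNF α φ = All (SatClause α) φ

x : ∀ {n m} → Fin n → Var n m
x i = inj₁ i

negx : ∀ {n m} → Fin n → Lit (Var n m)
negx i = (x i , false)

record IsGenPEncoding (n m : ℕ) (φ : CNF (Var n m)) : Set where
  field
    sat-xi : (i : Fin n) → ∃[ α ] (SatCNF α φ × α (x i) ≡ true)
    amo    : (i j : Fin n) → i ≢ j → (α : Assignment (Var n m)) → SatCNF α φ →
             SatLit α (negx i) ⊎ SatLit α (negx j)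

data RemoveLit {A : Set} : List A → List A → Set where
  here  : ∀ {l C} → RemoveLit (l ∷ C) C
  there : ∀ {l C C'} → RemoveLit C C' → RemoveLit (l ∷ C) (l ∷ C')

data RemoveLitFromClause {A : Set} : List (List A) → List (List A) → Set where
  here  : ∀ {C C' φ} → RemoveLit C C' → RemoveLitFromClause (C ∷ φ) (C' ∷ φ)
  there : ∀ {C φ ψ} → RemoveLitFromClause φ ψ → RemoveLitFromClause (C ∷ φ) (C ∷ ψ)

IsPrime : (n m : ℕ) → CNF (Var n m) → Set
IsPrime n m φ = (ψ : CNF (Var n m)) → RemoveLitFromClause φ ψ → ¬ IsGenPEncoding n m ψ

IsClauseMinimum : (n m : ℕ) → CNF (Var n m) → Set
IsClauseMinimum n m φ =
  (m' : ℕ) (ψ : CNF (Var n m')) → IsGenPEncoding n m' ψ → length φ ≤ length ψ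

MoreThanOneClauseWithNeg : ∀ {n m} → CNF (Var n m) → Fin n → Set
MoreThanOneClauseWithNeg φ i =
  Σ (Fin (length φ)) λ k₁ → Σ (Fin (length φ)) λ k₂ →
    (k₁ ≢ k₂) × (negx i ∈ lookup φ k₁) × (negx i ∈ lookup φ k₂)

-- Setting xᵢ to true can only falsify clauses containing x̄ᵢ, and it must turn
-- every model of φ ∧ xⱼ (j ≠ i) into a non-model. Hence some clause contains x̄ᵢ;
-- suppose C is the only one. Then α[xᵢ ≔ true] falsifies C for every model α of
-- φ ∧ xⱼ with j ≠ i. A model of φ ∧ xᵢ satisfies a literal ℓ ≠ x̄ᵢ of C, and by
-- primality every model of φ ∧ xᵢ satisfies ℓ, since otherwise ℓ could be
-- deleted from C. With n ≥ 3 no input literal ℓ is compatible with both facts.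
-- If ℓ = (y, b) for an auxiliary y, then y agrees with (xᵢ, b) on all the models
-- witnessing (a), so substituting (xᵢ, b) for y in the clauses other than C
-- gives an encoding with fewer clauses.
module Submission where

open import Defs
open import Data.Nat using (ℕ; _≤_; s≤s)
open import Data.Nat.Properties using (<-irrefl)
open import Data.Fin using (Fin; zero; suc) renaming (_≟_ to _≟ᶠ_)
open import Data.Fin.Properties using (suc-injective)
open import Data.Bool using (Bool; true; false; not; if_then_else_) renaming (_≟_ to _≟ᵇ_)
open import Data.Bool.Properties using (¬-not; not-involutive)
open import Data.Sum using (inj₁; inj₂)
import Data.Sum as Sum
open import Data.Sum.Properties using (inj₁-injective) renaming (≡-dec to ⊎-≡-dec)
open import Data.Product using (_×_; _,_; Σ; ∃-syntax; proj₁; proj₂)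
open import Data.Product.Properties using () renaming (≡-dec to ×-≡-dec)
open import Data.List using (List; []; _∷_; _++_; map; length; lookup)
open import Data.List.Properties using (length-map; length-++-sucʳ)
open import Data.List.Relation.Unary.All using (All; []; _∷_)
import Data.List.Relation.Unary.All as All
import Data.List.Relation.Unary.All.Properties as All
open import Data.List.Relation.Unary.Any using (Any; here; there; _─_)
import Data.List.Relation.Unary.Any as Any
import Data.List.Relation.Unary.Any.Properties as Any
open import Data.List.Membership.Propositional using (_∈_; _∉_; find; lose)
import Data.List.Membership.DecPropositional as DecMembership
open import Data.List.Relation.Binary.Permutation.Propositional using (↭-sym)
open import Data.List.Relation.Binary.Permutation.Propositional.Properties using (All-resp-↭; shift)
open import Data.Empty using (⊥; ⊥-elim)
open import Function using (_∘_)
open import Relation.Binary.Definitions using (DecidableEquality)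
open import Relation.Binary.PropositionalEquality
open import Relation.Nullary using (¬_; yes; no)
open import Relation.Unary using (Decidable)

true≢false : true ≢ false
true≢false ()

avoid-two : ∀ {n} → 3 ≤ n → (i k : Fin n) → ∃[ j ] (j ≢ i × j ≢ k)
avoid-two (s≤s (s≤s (s≤s _))) zero          zero          = suc zero , (λ ()) , (λ ())
avoid-two (s≤s (s≤s (s≤s _))) zero          (suc zero)    = suc (suc zero) , (λ ()) , (λ ())
avoid-two (s≤s (s≤s (s≤s _))) zero          (suc (suc _)) = suc zero , (λ ()) , (λ ())
avoid-two (s≤s (s≤s (s≤s _))) (suc zero)    zero          = suc (suc zero) , (λ ()) , (λ ())
avoid-two (s≤s (s≤s (s≤s _))) (suc (suc _)) zero          = suc zero , (λ ()) , (λ ())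
avoid-two (s≤s (s≤s (s≤s _))) (suc _)       (suc _)       = zero , (λ ()) , (λ ())

infix 5 _==_
_==_ : Bool → Bool → Bool
a == b = if a then b else not b

==-swap : ∀ a s c → a ≡ (c == s) → (a == s) ≡ c
==-swap _ true  true  refl = refl
==-swap _ false true  refl = refl
==-swap _ true  false refl = refl
==-swap _ false false refl = refl

module _ {A : Set} (P : A → Set) where

  TwoPositions : List A → Set
  TwoPositions xs = Σ (Fin (length xs)) λ k₁ → Σ (Fin (length xs)) λ k₂ →
    (k₁ ≢ k₂) × P (lookup xs k₁) × P (lookup xs k₂)

  data Occurrences : List A → Set where
    none  : ∀ {xs} → All (¬_ ∘ P) xs → Occurrences xs
    once  : ∀ ys {z} zs → P z → All (¬_ ∘ P) (ys ++ zs) → Occurrences (ys ++ z ∷ zs)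
    twice : ∀ {xs} → TwoPositions xs → Occurrences xs

module _ {A : Set} {P : A → Set} where

  occurrences : Decidable P → (xs : List A) → Occurrences P xs
  occurrences P? [] = none []
  occurrences P? (x ∷ xs) with P? x | occurrences P? xs
  ... | _      | twice (k₁ , k₂ , k₁≢k₂ , p₁ , p₂) =
    twice (suc k₁ , suc k₂ , k₁≢k₂ ∘ suc-injective , p₁ , p₂)
  ... | yes px | none ¬ps = once [] xs px ¬ps
  ... | no ¬px | none ¬ps = none (¬px ∷ ¬ps)
  ... | yes px | once ys {z} zs pz ¬ps =
    twice (zero , suc (Any.index later) , (λ ()) , px , Any.lookup-index later)
    where
    later : Any P (ys ++ z ∷ zs)
    later = Any.++⁺ʳ ys (here pz)
  ... | no ¬px | once ys zs pz ¬ps = once (x ∷ ys) zs pz (¬px ∷ ¬ps)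

  All-++-∷⁻ : ∀ xs {y zs} → All P (xs ++ y ∷ zs) → P y × All P (xs ++ zs)
  All-++-∷⁻ xs {y} {zs} ps with All-resp-↭ (shift y xs zs) ps
  ... | py ∷ ps′ = py , ps′

  All-++-∷⁺ : ∀ xs {y zs} → P y → All P (xs ++ zs) → All P (xs ++ y ∷ zs)
  All-++-∷⁺ xs {y} {zs} py ps = All-resp-↭ (↭-sym (shift y xs zs)) (py ∷ ps)

module _ {A : Set} where

  ─-removes : ∀ {P : A → Set} {xs} (p : Any P xs) → RemoveLit xs (xs ─ p)
  ─-removes (here _)  = here
  ─-removes (there p) = there (─-removes p)

  Any-─ : ∀ {Q : A → Set} {x xs} (x∈xs : x ∈ xs) → Any Q xs → ¬ Q x → Any Q (xs ─ x∈xs)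
  Any-─ (here refl)  (here qx)  ¬qx = ⊥-elim (¬qx qx)
  Any-─ (here refl)  (there qs) ¬qx = qs
  Any-─ (there x∈xs) (here qy)  ¬qx = here qy
  Any-─ (there x∈xs) (there qs) ¬qx = there (Any-─ x∈xs qs ¬qx)

  Any-RemoveLit : ∀ {P : A → Set} {xs ys} → RemoveLit xs ys → Any P ys → Any P xs
  Any-RemoveLit here      ps         = there ps
  Any-RemoveLit (there r) (here px)  = here px
  Any-RemoveLit (there r) (there ps) = there (Any-RemoveLit r ps)

  All-Any-RemoveLitFromClause : ∀ {P : A → Set} {xss yss} →
    RemoveLitFromClause xss yss → All (Any P) yss → All (Any P) xss
  All-Any-RemoveLitFromClause (here r)  (ps ∷ pss) = Any-RemoveLit r ps ∷ pss
  All-Any-RemoveLitFromClause (there r) (ps ∷ pss) = ps ∷ All-Any-RemoveLitFromClause r pss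

  RemoveLitFromClause-middle : ∀ (xss : List (List A)) {xs ys yss} →
    RemoveLit xs ys → RemoveLitFromClause (xss ++ xs ∷ yss) (xss ++ ys ∷ yss)
  RemoveLitFromClause-middle []        r = here r
  RemoveLitFromClause-middle (_ ∷ xss) r = there (RemoveLitFromClause-middle xss r)

module _ {V W : Set} where

  sat-map⁺ : ∀ {α : Assignment V} {β : Assignment W} {f : Lit V → Lit W} →
    (∀ {L} → SatLit α L → SatLit β (f L)) →
    ∀ {φ} → SatCNF α φ → SatCNF β (map (map f) φ)
  sat-map⁺ f⁺ = All.map⁺ ∘ All.map (Any.map⁺ ∘ Any.map f⁺)

  sat-map⁻ : ∀ {α : Assignment W} {β : Assignment V} {f : Lit V → Lit W} →
    (∀ {L} → SatLit α (f L) → SatLit β L) →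
    ∀ {φ} → SatCNF α (map (map f) φ) → SatCNF β φ
  sat-map⁻ f⁻ = All.map (Any.map f⁻ ∘ Any.map⁻) ∘ All.map⁻

module Assignments {V : Set} (_≟_ : DecidableEquality V) where

  _[_≔_] : Assignment V → V → Bool → Assignment V
  (α [ v ≔ b ]) w with w ≟ v
  ... | yes _ = b
  ... | no  _ = α w

  update-≡ : ∀ α v b → (α [ v ≔ b ]) v ≡ b
  update-≡ α v b with v ≟ v
  ... | yes _   = refl
  ... | no v≢v = ⊥-elim (v≢v refl)

  update-≢ : ∀ α b {v w} → w ≢ v → (α [ v ≔ b ]) w ≡ α w
  update-≢ α b {v} {w} w≢v with w ≟ v
  ... | yes w≡v = ⊥-elim (w≢v w≡v)
  ... | no  _   = refl

  sat-update : ∀ {α v b} {φ : CNF V} → All ((v , not b) ∉_) φ →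
    SatCNF α φ → SatCNF (α [ v ≔ b ]) φ
  sat-update [] [] = []
  sat-update (∉C ∷ ∉φ) (αC ∷ αφ) = clause ∉C αC ∷ sat-update ∉φ αφ
    where
    literal : ∀ {α v b L} → L ≢ (v , not b) → SatLit α L → SatLit (α [ v ≔ b ]) L
    literal {α} {v} {b} {w , c} L≢ αL with w ≟ v
    ... | yes refl = sym (trans (¬-not (L≢ ∘ cong (v ,_))) (not-involutive b))
    ... | no  _    = αL

    clause : ∀ {α v b C} → (v , not b) ∉ C → SatClause α C → SatClause (α [ v ≔ b ]) C
    clause ∉C (here αL)  = here (literal (∉C ∘ here ∘ sym) αL)
    clause ∉C (there αC) = there (clause (∉C ∘ there) αC)

  value : Lit V → Assignment V → Bool
  value (u , s) γ = γ u == s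

  substLit : V → Lit V → Lit V → Lit V
  substLit y (u , s) (v , c) with v ≟ y
  ... | yes _ = u , c == s
  ... | no  _ = v , c

  substCNF : V → Lit V → CNF V → CNF V
  substCNF y ℓ = map (map (substLit y ℓ))

  sat-subst⁺ : ∀ {γ y ℓ} → γ y ≡ value ℓ γ → ∀ {φ} → SatCNF γ φ → SatCNF γ (substCNF y ℓ φ)
  sat-subst⁺ {γ} {y} {u , s} γy = sat-map⁺ literal
    where
    literal : ∀ {L} → SatLit γ L → SatLit γ (substLit y (u , s) L)
    literal {v , c} γL with v ≟ y
    ... | yes refl = sym (==-swap c s (γ u) (trans (sym γL) γy))
    ... | no  _    = γL

  sat-subst⁻ : ∀ {γ y ℓ φ} → SatCNF γ (substCNF y ℓ φ) → SatCNF (γ [ y ≔ value ℓ γ ]) φ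
  sat-subst⁻ {γ} {y} {u , s} = sat-map⁻ literal
    where
    literal : ∀ {L} → SatLit γ (substLit y (u , s) L) → SatLit (γ [ y ≔ value (u , s) γ ]) L
    literal {v , c} γL with v ≟ y
    ... | yes refl = ==-swap (γ u) s c γL
    ... | no  _    = γL

_≟ⱽ_ : ∀ {n m} → DecidableEquality (Var n m)
_≟ⱽ_ = ⊎-≡-dec _≟ᶠ_ _≟ᶠ_

_≟ᴸ_ : ∀ {n m} → DecidableEquality (Lit (Var n m))
_≟ᴸ_ = ×-≡-dec _≟ⱽ_ _≟ᵇ_

module _ {n m : ℕ} where
  open Assignments (_≟ⱽ_ {n} {m})
  open IsGenPEncoding

  amo-true : ∀ {φ i j α} → IsGenPEncoding n m φ → j ≢ i → SatCNF α φ →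
    α (x j) ≡ true → α (x i) ≡ false
  amo-true {i = i} {j} {α} enc j≢i αφ αj with amo enc j i j≢i α αφ
  ... | inj₁ αj≡false = ⊥-elim (true≢false (trans (sym αj) αj≡false))
  ... | inj₂ αi≡false = αi≡false

  set-x-not-model : ∀ {φ i k α} → IsGenPEncoding n m φ → k ≢ i → α (x k) ≡ true →
    ¬ SatCNF (α [ x i ≔ true ]) φ
  set-x-not-model {i = i} {α = α} enc k≢i αk model =
    true≢false (trans (sym (update-≡ α (x i) true))
                      (amo-true enc k≢i model (trans (update-≢ α true (k≢i ∘ inj₁-injective)) αk)))

  ¬-encoding-without-negx : ∀ {φ i j} → IsGenPEncoding n m φ → j ≢ i →
    ¬ All (negx i ∉_) φ
  ¬-encoding-without-negx {j = j} enc j≢i x̄ᵢ∉φ =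
    let α , αφ , αj = sat-xi enc j in set-x-not-model enc j≢i αj (sat-update x̄ᵢ∉φ αφ)

  encoding-transfer : ∀ {m′ φ} {ψ : CNF (Var n m′)} → IsGenPEncoding n m φ →
    ((k : Fin n) → ∃[ α ] (SatCNF α ψ × α (x k) ≡ true)) →
    ((β : Assignment (Var n m′)) → SatCNF β ψ →
      ∃[ δ ] (SatCNF δ φ × ((k : Fin n) → δ (x k) ≡ β (x k)))) →
    IsGenPEncoding n m′ ψ
  sat-xi (encoding-transfer enc models back) = models
  amo (encoding-transfer enc models back) i j i≢j β βψ =
    let δ , δφ , δ≗β = back β βψ
    in Sum.map (trans (sym (δ≗β i))) (trans (sym (δ≗β j))) (amo enc i j i≢j δ δφ)

module OneOccurrence {n m : ℕ} {i : Fin n} (φ₁ : CNF (Var n m)) {C : Clause (Var n m)}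
  {φ₂ : CNF (Var n m)} (enc : IsGenPEncoding n m (φ₁ ++ C ∷ φ₂))
  (x̄ᵢ∈C : negx i ∈ C) (x̄ᵢ∉R : All (negx i ∉_) (φ₁ ++ φ₂)) where

  open Assignments (_≟ⱽ_ {n} {m})
  open IsGenPEncoding enc

  φ R : CNF (Var n m)
  φ = φ₁ ++ C ∷ φ₂
  R = φ₁ ++ φ₂

  C-sat : ∀ {α} → SatCNF α φ → SatClause α C
  C-sat = proj₁ ∘ All-++-∷⁻ φ₁

  R-sat : ∀ {α} → SatCNF α φ → SatCNF α R
  R-sat = proj₂ ∘ All-++-∷⁻ φ₁

  set-xᵢ-falsifies-C : ∀ {k α L} → k ≢ i → SatCNF α φ → α (x k) ≡ true → L ∈ C →
    ¬ SatLit (α [ x i ≔ true ]) L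
  set-xᵢ-falsifies-C k≢i αφ αk L∈C αL =
    set-x-not-model enc k≢i αk (All-++-∷⁺ φ₁ (lose L∈C αL) (sat-update x̄ᵢ∉R (R-sat αφ)))

  EntailedWithXᵢ : Lit (Var n m) → Set
  EntailedWithXᵢ L = ∀ {γ} → SatCNF γ φ → γ (x i) ≡ true → SatLit γ L

  entailed-by-prime : IsPrime n m φ → ∀ {L} → L ∈ C → L ≢ negx i → EntailedWithXᵢ L
  entailed-by-prime prime {v , b} L∈C L≢x̄ᵢ {γ} γφ γi with γ v ≟ᵇ b
  ... | yes γL = γL
  ... | no  γ⊭L = ⊥-elim (prime ψ removal (encoding-transfer enc models back))
    where
    ψ : CNF (Var n m)
    ψ = φ₁ ++ (C ─ L∈C) ∷ φ₂

    removal : RemoveLitFromClause φ ψ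
    removal = RemoveLitFromClause-middle φ₁ (─-removes L∈C)

    models : (k : Fin n) → ∃[ α ] (SatCNF α ψ × α (x k) ≡ true)
    models k with k ≟ᶠ i
    ... | yes refl = γ , All-++-∷⁺ φ₁ (Any-─ L∈C (C-sat γφ) γ⊭L) (R-sat γφ) , γi
    ... | no  k≢i  =
      let α , αφ , αk = sat-xi k
          x̄ᵢ∈C─L = Any-─ L∈C x̄ᵢ∈C (L≢x̄ᵢ ∘ sym)
      in α , All-++-∷⁺ φ₁ (lose x̄ᵢ∈C─L (amo-true enc k≢i αφ αk)) (R-sat αφ) , αk

    back : ∀ β → SatCNF β ψ → ∃[ δ ] (SatCNF δ φ × ((k : Fin n) → δ (x k) ≡ β (x k)))
    back β βψ = β , All-Any-RemoveLitFromClause removal βψ , λ _ → refl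

  input-literal-impossible : 3 ≤ n → ∀ k b → (x k , b) ∈ C → EntailedWithXᵢ (x k , b) → ⊥
  input-literal-impossible n≥3 k b l∈C entailed with k ≟ᶠ i | b
  ... | yes refl | true =
    let j , j≢i , _ = avoid-two n≥3 i i
        α , αφ , αj = sat-xi j
    in set-xᵢ-falsifies-C j≢i αφ αj l∈C (update-≡ α (x i) true)
  ... | yes refl | false =
    let β , βφ , βi = sat-xi i in true≢false (trans (sym βi) (entailed βφ βi))
  ... | no k≢i | true =
    let β , βφ , βi = sat-xi i
    in true≢false (trans (sym (entailed βφ βi)) (amo-true enc (k≢i ∘ sym) βφ βi))
  ... | no k≢i | false =
    let j , j≢i , j≢k = avoid-two n≥3 i k
        α , αφ , αj = sat-xi j
    in set-xᵢ-falsifies-C j≢i αφ αj l∈C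
         (trans (update-≢ α true (k≢i ∘ inj₁-injective)) (amo-true enc j≢k αφ αj))

  auxiliary-literal-impossible : IsClauseMinimum n m φ →
    ∀ y b → (inj₂ y , b) ∈ C → EntailedWithXᵢ (inj₂ y , b) → ⊥
  auxiliary-literal-impossible minimal y b l∈C entailed =
    <-irrefl (sym (length-map (map (substLit (inj₂ y) ℓ)) R))
             (subst (_≤ length ψ) (length-++-sucʳ φ₁ C φ₂) (minimal m ψ ψ-encoding))
    where
    ℓ : Lit (Var n m)
    ℓ = x i , b

    y≢x : ∀ k → inj₂ y ≢ x k
    y≢x _ ()

    ψ : CNF (Var n m)
    ψ = substCNF (inj₂ y) ℓ R

    y-tracks-xᵢ : ∀ {k α} → SatCNF α φ → α (x k) ≡ true → α (inj₂ y) ≡ value ℓ α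
    y-tracks-xᵢ {k} {α} αφ αk with k ≟ᶠ i
    ... | yes refl = trans (entailed αφ αk) (cong (_== b) (sym αk))
    ... | no  k≢i  =
      trans (¬-not (set-xᵢ-falsifies-C k≢i αφ αk l∈C ∘ trans (update-≢ α true (y≢x i))))
            (cong (_== b) (sym (amo-true enc k≢i αφ αk)))

    C-sat-after-update : ∀ β → SatClause (β [ inj₂ y ≔ value ℓ β ]) C
    C-sat-after-update β with β (x i) in βi
    ... | true  = lose l∈C (update-≡ β (inj₂ y) b)
    ... | false = lose x̄ᵢ∈C (trans (update-≢ β (not b) (y≢x i ∘ sym)) βi)

    ψ-encoding : IsGenPEncoding n m ψ
    ψ-encoding = encoding-transfer enc
      (λ k → let α , αφ , αk = sat-xi k in α , sat-subst⁺ (y-tracks-xᵢ αφ αk) (R-sat αφ) , αk)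
      (λ β βψ → β [ inj₂ y ≔ value ℓ β ]
              , All-++-∷⁺ φ₁ (C-sat-after-update β) (sat-subst⁻ βψ)
              , λ k → update-≢ β (value ℓ β) (y≢x k ∘ sym))

  impossible : 3 ≤ n → IsPrime n m φ → IsClauseMinimum n m φ → ⊥
  impossible n≥3 prime minimal =
    let β , βφ , βi = sat-xi i
        l , l∈C , βl = find (C-sat βφ)
    in literal-impossible l∈C (entailed-by-prime prime l∈C (≢-negx β βi βl))
    where
    ≢-negx : ∀ γ {L} → γ (x i) ≡ true → SatLit γ L → L ≢ negx i
    ≢-negx _ γi γL refl = true≢false (trans (sym γi) γL)

    literal-impossible : ∀ {L} → L ∈ C → EntailedWithXᵢ L → ⊥
    literal-impossible {inj₁ k , b} = input-literal-impossible n≥3 k b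
    literal-impossible {inj₂ y , b} = auxiliary-literal-impossible minimal y b

lemma17 : (n m : ℕ) → 3 ≤ n → (φ : CNF (Var n m)) →
          IsGenPEncoding n m φ → IsPrime n m φ → IsClauseMinimum n m φ →
          (i : Fin n) → MoreThanOneClauseWithNeg φ i
lemma17 n m n≥3 φ enc prime minimal i with occurrences (DecMembership._∈?_ _≟ᴸ_ (negx i)) φ
... | twice two = two
... | none x̄ᵢ∉φ =
  let j , j≢i , _ = avoid-two n≥3 i i in ⊥-elim (¬-encoding-without-negx enc j≢i x̄ᵢ∉φ)
... | once φ₁ φ₂ x̄ᵢ∈C x̄ᵢ∉R = ⊥-elim (OneOccurrence.impossible φ₁ enc x̄ᵢ∈C x̄ᵢ∉R n≥3 prime minimal)
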